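{- Let $\alpha=(1^{f_1},2^{e_1},1^{f_2},\dots,1^{f_{k-1}},2^{e_{k-1}},1^{f_k})$ where $f_1,f_k\in\mathbb{N}_0$, $f_2,\dots,f_{k-1}\in\mathbb{N}$ and $e_1,\dots,e_{k-1}\in\mathbb{N}$. Then $$\mathcal{S}_\alpha=\sum_{(\gamma_1,\dots,\gamma_{k-1})}\Big(\prod_{i=1}^{k-1}d_{(2^{e_i})\gamma_i}\Big)F_{(1^{f_1})\cdot\gamma_1\cdot(1^{f_2})\cdot\gamma_2\cdots(1^{f_{k-1}})\cdot\gamma_{k-1}\cdot(1^{f_k})},$$ where the sum runs over all $(k-1)$-tuples of compositions $(\gamma_1,\dots,\gamma_{k-1})$ with $\gamma_i\vDash 2e_i$ for $i=1,\dots,k-1$.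
   Context: $i^m$ denotes $m$ consecutive parts equal to $i$ (omitted if $m=0$), $\cdot$ denotes concatenation of compositions, $\mathbb{N}_0=\{0,1,\dots\}$, $\mathbb{N}=\{1,2,\dots\}$. For $\beta\vDash n$, $\mathrm{set}(\beta)=\{\beta_1,\beta_1+\beta_2,\dots\}$ (partial sums excluding $n$) and $F_\beta=\sum x_{i_1}\cdots x_{i_n}$ over $i_1\le\cdots\le i_n$ with $i_j<i_{j+1}$ whenever $j\in\mathrm{set}(\beta)$. The composition diagram of $\alpha$ has $\alpha_i$ left-justified cells in row $i$ (top to bottom). Cover relation: $\beta\lessdot\gamma$ if $\gamma=(1)\cdot\beta$ (new top row of one cell) or $\gamma$ is obtained from $\beta$ by adding $1$ to the leftmost part of $\beta$ equal to $k$, for some $k$ (cell added at the right end of that row). A standard composition tableau (SCT) of shape $\alpha\vDash n$ comes from a chain $\emptyset=\alpha^{n+1}\lessdot\cdots\lessdot\alpha^1=\alpha$ by putting $i$ in the cell added from $\alpha^{i+1}$ to $\alpha^i$. Its descent set is the set of $i$ with $i+1$ in a column weakly right of that of $i$; $\mathrm{com}(T)$ is the composition with this set. $\mathcal{S}_\alpha=\sum_T F_{\mathrm{com}(T)}$ over SCT $T$ of shape $\alpha$, and $d_{\alpha\beta}$ denotes the coefficient of $F_\beta$ in $\mathcal{S}_\alpha$ (the number of SCT of shape $\alpha$ with $\mathrm{com}(T)=\beta$). -}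

module Defs where

open import Data.Nat using (ℕ; zero; suc; _+_; _*_; _≤ᵇ_; _≟_)
open import Data.Bool using (Bool; true; false; if_then_else_)
open import Data.List using (List; []; _∷_; _++_; map; concatMap; filter; reverse; replicate)
open import Data.Nat.ListAction using (sum)
open import Data.List.Properties using (≡-dec)
open import Data.Vec using (Vec; []; _∷_)
open import Data.Product using (_×_; _,_; proj₁; proj₂)
open import Relation.Nullary using (yes; no; ¬_; Dec)
open import Relation.Binary.PropositionalEquality using (_≡_)
open import Relation.Nullary.Decidable using (¬?; ⌊_⌋)

-- Compositions are lists of (positive) natural numbers, parts listed top to bottom.
Comp : Set
Comp = List ℕ

_≟c_ : (a b : Comp) → Dec (a ≡ b)
_≟c_ = ≡-dec _≟_

-- Formal ℕ-linear combinations of fundamental quasisymmetric functions F_β.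
-- Since the F_β form a basis of QSym, a quasisymmetric function with
-- nonnegative integer F-coefficients is determined by its coefficient
-- function; two formal sums are equal iff their coefficients agree.

LinComb : Set
LinComb = List (ℕ × Comp)

coeff : LinComb → Comp → ℕ
coeff [] β = 0
coeff ((c , γ) ∷ xs) β with γ ≟c β
... | yes _ = c + coeff xs β
... | no  _ = coeff xs β

-- Cover relation: all γ with β ⋖ γ, together with the column of the added cell.

-- add 1 to the leftmost part equal to k, for each k occurring in β;
-- a cell added to a row with k cells lies in column k+1.
incs : Comp → List (Comp × ℕ)
incs [] = []
incs (x ∷ xs) =
  (suc x ∷ xs , suc x) ∷
  map (λ p → (x ∷ proj₁ p , proj₂ p))
      (filter (λ p → ¬? (proj₂ p ≟ suc x)) (incs xs))

covers : Comp → List (Comp × ℕ)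
covers β = ((1 ∷ β) , 1) ∷ incs β

-- all saturated chains ∅ = α^{m+1} ⋖ ... ⋖ α^1 of length m, recorded as
-- (top shape, list of columns of the added cells in the order they were added).
-- The cell added last receives entry 1, the first one entry m.
chains : ℕ → List (Comp × List ℕ)
chains zero = ([] , []) ∷ []
chains (suc m) =
  concatMap (λ p → map (λ q → (proj₁ q , proj₂ p ++ (proj₂ q ∷ [])))
                       (covers (proj₁ p)))
            (chains m)

-- composition of n with descent set {i : col(i+1) ≥ col(i)},
-- given the list col(1), ..., col(n)
comFrom : ℕ → List ℕ → Comp
comFrom acc [] = []
comFrom acc (a ∷ []) = acc ∷ []
comFrom acc (a ∷ b ∷ rest) =
  if a ≤ᵇ b then acc ∷ comFrom 1 (b ∷ rest) else comFrom (suc acc) (b ∷ rest)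

-- com(T) for the SCT given by a chain (columns listed in order of addition)
comOf : List ℕ → Comp
comOf cols = comFrom 1 (reverse cols)

-- SCTs of shape α (as chains of length |α| ending at α)
sctsOf : Comp → List (Comp × List ℕ)
sctsOf α = filter (λ p → proj₁ p ≟c α) (chains (sum α))

S : Comp → LinComb
S α = map (λ p → (1 , comOf (proj₂ p))) (sctsOf α)

d : Comp → Comp → ℕ
d α β = coeff (S α) β

compsSuc : ℕ → List Comp          -- compositions of suc n
compsSuc zero = (1 ∷ []) ∷ []
compsSuc (suc n) = concatMap step (compsSuc n)
  where
  step : Comp → List Comp
  step [] = []
  step (x ∷ xs) = (1 ∷ x ∷ xs) ∷ (suc x ∷ xs) ∷ []

comps : ℕ → List Comp
comps zero = [] ∷ []
comps (suc n) = compsSuc n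

-- The shape α = (1^{f_1}, 2^{e_1}, 1^{f_2}, ..., 2^{e_{k-1}}, 1^{f_k}),
-- with m = k - 1, f = (f_1,...,f_k), e = (e_1,...,e_{k-1}).
alphaShape : ∀ {m} → Vec ℕ (suc m) → Vec ℕ m → Comp
alphaShape (f ∷ []) [] = replicate f 1
alphaShape (f ∷ fs@(_ ∷ _)) (e ∷ es) = replicate f 1 ++ replicate e 2 ++ alphaShape fs es

tuples : ∀ {m} → Vec ℕ m → List (Vec Comp m)
tuples [] = [] ∷ []
tuples (e ∷ es) = concatMap (λ γ → map (γ ∷_) (tuples es)) (comps (2 * e))

prodD : ∀ {m} → Vec ℕ m → Vec Comp m → ℕ
prodD [] [] = 1
prodD (e ∷ es) (γ ∷ γs) = d (replicate e 2) γ * prodD es γs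

assemble : ∀ {m} → Vec ℕ (suc m) → Vec Comp m → Comp
assemble (f ∷ []) [] = replicate f 1
assemble (f ∷ fs@(_ ∷ _)) (γ ∷ γs) = replicate f 1 ++ γ ++ assemble fs γs

rhs : ∀ {m} → Vec ℕ (suc m) → Vec ℕ m → LinComb
rhs f e = map (λ γs → (prodD e γs , assemble f γs)) (tuples e)

-- A standard composition tableau of shape α is a chain of covers ending at α; record it by the
-- columns of its cells in the order they are added.  Let ρ have parts ≤ 2 and top row 1.  A cover of
-- a shape not ending in ρ never ends in ρ: inside ρ it could only turn a row of length 1 below the top
-- row into one of length 2, and the cover relation picks the top row instead.  Hence every chain to
-- τ · ρ passes through ρ and then grows τ as an independent chain: the SCT of τ · ρ are the pairs
-- (SCT of ρ, SCT of τ), the cells of τ carrying the smaller entries.  For α = 1^{f₁} · 2^{e₁} · ρ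
-- the rows 1^{f₁} take the entries 1, …, f₁, and every junction between blocks is a descent because
-- the largest entry of a block is its first cell, in column 1.  So com(T) = 1^{f₁} · com(T₁) · com(T_ρ);
-- summing over the SCT T₁ of 2^{e₁} with com(T₁) = γ₁ gives d_{(2^{e₁}) γ₁}, and induction on the
-- number of blocks finishes the proof.

module Submission where

open import Defs
open import Data.Bool using (true; false; if_then_else_)
open import Data.Bool.Properties using (if-float)
open import Data.Empty using (⊥; ⊥-elim)
open import Data.Fin using (Fin; toℕ) renaming (zero to fzero; suc to fsuc)
open import Data.List using (List; []; _∷_; _++_; _∷ʳ_; map; concatMap; filter; reverse; replicate; length)
open import Data.List.Properties
  using ( ++-assoc; ++-identityʳ; length-++; ∷-injectiveʳ; ∷-injectiveˡ; ++-cancelʳ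
        ; reverse-++; unfold-reverse; length-reverse)
open import Data.List.Relation.Unary.All as All using (All; []; _∷_)
open import Data.List.Relation.Unary.All.Properties
  using (++⁺; ++⁻ˡ; ∷ʳ⁺; map⁺; concat⁺; filter⁺; all-filter; replicate⁺)
open import Data.Maybe using (Maybe; just; nothing; maybe′)
open import Data.Maybe.Properties using (maybe′-map)
open import Data.Nat using (ℕ; zero; suc; _+_; _*_; _≤_; _<_; z≤n; s≤s; _≟_; _≤ᵇ_)
open import Data.Nat.Properties
open import Algebra.Properties.CommutativeSemigroup +-commutativeSemigroup using (interchange)
open import Algebra.Properties.CommutativeSemigroup *-commutativeSemigroup using (x∙yz≈y∙xz)
open import Data.Nat.ListAction using (sum)
open import Data.Nat.ListAction.Properties using (sum-++)
open import Data.Product using (∃-syntax; _×_; _,_; proj₁; proj₂)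
open import Data.Unit using (⊤; tt)
open import Data.Vec using (Vec; []; _∷_; lookup)
open import Function using (_∘_)
open import Relation.Nullary using (yes; no; ¬_; Dec; does; contradiction)
open import Relation.Nullary.Decidable using (¬?)
open import Relation.Unary using (Decidable)
open import Relation.Binary.PropositionalEquality

private
  variable
    A B : Set

-- Finite sums and lists

∑ : List A → (A → ℕ) → ℕ
∑ [] f = 0
∑ (x ∷ xs) f = f x + ∑ xs f

infix 5 ∑
syntax ∑ xs (λ x → e) = ∑[ x ∈ xs ] e

∑-++ : (xs ys : List A) (f : A → ℕ) → ∑ (xs ++ ys) f ≡ ∑ xs f + ∑ ys f
∑-++ [] ys f = refl
∑-++ (x ∷ xs) ys f = trans (cong (f x +_) (∑-++ xs ys f)) (sym (+-assoc (f x) _ _))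

∑-map : (g : A → B) (xs : List A) (f : B → ℕ) → ∑ (map g xs) f ≡ ∑[ x ∈ xs ] f (g x)
∑-map g [] f = refl
∑-map g (x ∷ xs) f = cong (f (g x) +_) (∑-map g xs f)

∑-concatMap : (g : A → List B) (xs : List A) (f : B → ℕ) →
  ∑ (concatMap g xs) f ≡ ∑[ x ∈ xs ] ∑ (g x) f
∑-concatMap g [] f = refl
∑-concatMap g (x ∷ xs) f =
  trans (∑-++ (g x) (concatMap g xs) f) (cong (∑ (g x) f +_) (∑-concatMap g xs f))

∑-cong : (xs : List A) {f g : A → ℕ} → (∀ x → f x ≡ g x) → ∑ xs f ≡ ∑ xs g
∑-cong [] eq = refl
∑-cong (x ∷ xs) eq = cong₂ _+_ (eq x) (∑-cong xs eq)

∑-congᴬ : {P : A → Set} {xs : List A} {f g : A → ℕ} →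
  All P xs → (∀ x → P x → f x ≡ g x) → ∑ xs f ≡ ∑ xs g
∑-congᴬ [] eq = refl
∑-congᴬ (px ∷ pxs) eq = cong₂ _+_ (eq _ px) (∑-congᴬ pxs eq)

∑-zero : (xs : List A) → ∑[ x ∈ xs ] 0 ≡ 0
∑-zero [] = refl
∑-zero (x ∷ xs) = ∑-zero xs

∑-≡0 : {P : A → Set} {xs : List A} {f : A → ℕ} → All P xs → (∀ x → P x → f x ≡ 0) → ∑ xs f ≡ 0
∑-≡0 {xs = xs} pxs eq = trans (∑-congᴬ pxs eq) (∑-zero xs)

∑-*ˡ : (c : ℕ) (xs : List A) (f : A → ℕ) → c * ∑ xs f ≡ ∑[ x ∈ xs ] c * f x
∑-*ˡ c [] f = *-zeroʳ c
∑-*ˡ c (x ∷ xs) f = trans (*-distribˡ-+ c (f x) _) (cong (c * f x +_) (∑-*ˡ c xs f))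

∑-*ʳ : (c : ℕ) (xs : List A) (f : A → ℕ) → ∑ xs f * c ≡ ∑[ x ∈ xs ] f x * c
∑-*ʳ c xs f = trans (*-comm _ c) (trans (∑-*ˡ c xs f) (∑-cong xs (λ x → *-comm c (f x))))

∑-+ : (xs : List A) (f g : A → ℕ) → ∑[ x ∈ xs ] (f x + g x) ≡ ∑ xs f + ∑ xs g
∑-+ [] f g = refl
∑-+ (x ∷ xs) f g = trans (cong (f x + g x +_) (∑-+ xs f g)) (interchange (f x) (g x) _ _)

∑-swap : (xs : List A) (ys : List B) (F : A → B → ℕ) →
  ∑[ x ∈ xs ] ∑[ y ∈ ys ] F x y ≡ ∑[ y ∈ ys ] ∑[ x ∈ xs ] F x y
∑-swap [] ys F = sym (∑-zero ys)
∑-swap (x ∷ xs) ys F =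
  trans (cong (∑ ys (F x) +_) (∑-swap xs ys F)) (sym (∑-+ ys (F x) (λ y → ∑[ x ∈ xs ] F x y)))

∑-filter : {P : A → Set} (P? : Decidable P) (xs : List A) (f : A → ℕ) →
  ∑ (filter P? xs) f ≡ ∑[ x ∈ xs ] (if does (P? x) then f x else 0)
∑-filter P? [] f = refl
∑-filter P? (x ∷ xs) f with does (P? x)
... | true = cong (f x +_) (∑-filter P? xs f)
... | false = ∑-filter P? xs f

filter⁺-guarded : {P Q : A → Set} (P? : Decidable P) {xs : List A} →
  All (λ x → P x → Q x) xs → All Q (filter P? xs)
filter⁺-guarded P? {xs} h = All.zipWith (λ { (q , p) → q p }) (filter⁺ P? h , all-filter P? xs)

replicate-∷ʳ : ∀ n (x : A) → replicate n x ∷ʳ x ≡ x ∷ replicate n x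
replicate-∷ʳ zero x = refl
replicate-∷ʳ (suc n) x = cong (x ∷_) (replicate-∷ʳ n x)

reverse-replicate : ∀ n (x : A) → reverse (replicate n x) ≡ replicate n x
reverse-replicate zero x = refl
reverse-replicate (suc n) x =
  trans (unfold-reverse x (replicate n x)) (trans (cong (_∷ʳ x) (reverse-replicate n x)) (replicate-∷ʳ n x))

All-reverse⁺ : {P : A → Set} {xs : List A} → All P xs → All P (reverse xs)
All-reverse⁺ [] = []
All-reverse⁺ {xs = x ∷ xs} (px ∷ pxs) = subst (All _) (sym (unfold-reverse x xs)) (∷ʳ⁺ (All-reverse⁺ pxs) px)

-- Sums over standard composition tableaux

δ : Comp → Comp → ℕ
δ a b with a ≟c b
... | yes _ = 1
... | no _ = 0

δ-≢ : ∀ {a b} → a ≢ b → δ a b ≡ 0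
δ-≢ {a} {b} a≢b with a ≟c b
... | yes a≡b = contradiction a≡b a≢b
... | no _ = refl

δ-refl : ∀ a → δ a a ≡ 1
δ-refl a with a ≟c a
... | yes _ = refl
... | no a≢a = contradiction refl a≢a

δ-⇔ : ∀ {a b c d} → (a ≡ b → c ≡ d) → (c ≡ d → a ≡ b) → δ a b ≡ δ c d
δ-⇔ {a} {b} {c} {d} to from with a ≟c b | c ≟c d
... | yes _ | yes _ = refl
... | no _ | no _ = refl
... | yes p | no q = contradiction (to p) q
... | no p | yes q = contradiction (from q) p

δ-∷ : ∀ x a b → δ (x ∷ a) (x ∷ b) ≡ δ a b
δ-∷ x a b = δ-⇔ ∷-injectiveʳ (cong (x ∷_))

δ-suc : ∀ x y a b → δ (suc x ∷ a) (suc y ∷ b) ≡ δ (x ∷ a) (y ∷ b)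
δ-suc x y a b = δ-⇔
  (λ eq → cong₂ _∷_ (suc-injective (∷-injectiveˡ eq)) (∷-injectiveʳ eq))
  (λ eq → cong₂ _∷_ (cong suc (∷-injectiveˡ eq)) (∷-injectiveʳ eq))

δ-*-cong : ∀ a b {m n} → (a ≡ b → m ≡ n) → δ a b * m ≡ δ a b * n
δ-*-cong a b eq with a ≟c b
... | yes a≡b = cong (1 *_) (eq a≡b)
... | no _ = refl

coeff-map : (c : A → ℕ) (k : A → Comp) (xs : List A) (β : Comp) →
  coeff (map (λ x → (c x , k x)) xs) β ≡ ∑[ x ∈ xs ] c x * δ (k x) β
coeff-map c k [] β = refl
coeff-map c k (x ∷ xs) β with k x ≟c β
... | yes _ = cong₂ _+_ (sym (*-identityʳ (c x))) (coeff-map c k xs β)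
... | no _ = trans (coeff-map c k xs β) (cong (_+ (∑[ y ∈ xs ] c y * δ (k y) β)) (sym (*-zeroʳ (c x))))

-- h sees the columns of the cells in the order they are added, i.e. of the entries n, n − 1, …, 1.
sumSCT : Comp → (List ℕ → ℕ) → ℕ
sumSCT α h = ∑[ p ∈ chains (sum α) ] δ (proj₁ p) α * h (proj₂ p)

sumSCT-cong : ∀ α {h₁ h₂ : List ℕ → ℕ} → (∀ w → h₁ w ≡ h₂ w) → sumSCT α h₁ ≡ sumSCT α h₂
sumSCT-cong α eq = ∑-cong (chains (sum α)) (λ p → cong (δ (proj₁ p) α *_) (eq (proj₂ p)))

sumSCT-swap : ∀ α β (F : List ℕ → List ℕ → ℕ) →
  sumSCT α (λ v → sumSCT β (F v)) ≡ sumSCT β (λ w → sumSCT α (λ v → F v w))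
sumSCT-swap α β F = begin
  ∑[ p ∈ chains (sum α) ] δ (proj₁ p) α * sumSCT β (F (proj₂ p))
    ≡⟨ ∑-cong (chains (sum α)) (λ p → ∑-*ˡ (δ (proj₁ p) α) (chains (sum β)) _) ⟩
  ∑[ p ∈ chains (sum α) ] ∑[ q ∈ chains (sum β) ] δ (proj₁ p) α * (δ (proj₁ q) β * F (proj₂ p) (proj₂ q))
    ≡⟨ ∑-swap (chains (sum α)) (chains (sum β)) _ ⟩
  ∑[ q ∈ chains (sum β) ] ∑[ p ∈ chains (sum α) ] δ (proj₁ p) α * (δ (proj₁ q) β * F (proj₂ p) (proj₂ q))
    ≡⟨ ∑-cong (chains (sum β)) (λ q → ∑-cong (chains (sum α)) λ p →
         x∙yz≈y∙xz (δ (proj₁ p) α) (δ (proj₁ q) β) _) ⟩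
  ∑[ q ∈ chains (sum β) ] ∑[ p ∈ chains (sum α) ] δ (proj₁ q) β * (δ (proj₁ p) α * F (proj₂ p) (proj₂ q))
    ≡⟨ ∑-cong (chains (sum β)) (λ q → ∑-*ˡ (δ (proj₁ q) β) (chains (sum α)) _) ⟨
  ∑[ q ∈ chains (sum β) ] δ (proj₁ q) β * sumSCT α (λ v → F v (proj₂ q)) ∎
  where open ≡-Reasoning

coeff-S : ∀ α β → coeff (S α) β ≡ sumSCT α (λ w → δ (comOf w) β)
coeff-S α β = begin
  coeff (S α) β
    ≡⟨ coeff-map (λ _ → 1) (comOf ∘ proj₂) (filter (λ p → proj₁ p ≟c α) (chains (sum α))) β ⟩
  ∑[ p ∈ filter (λ p → proj₁ p ≟c α) (chains (sum α)) ] 1 * δ (comOf (proj₂ p)) β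
    ≡⟨ ∑-filter (λ p → proj₁ p ≟c α) (chains (sum α)) _ ⟩
  ∑[ p ∈ chains (sum α) ] (if does (proj₁ p ≟c α) then 1 * δ (comOf (proj₂ p)) β else 0)
    ≡⟨ ∑-cong (chains (sum α)) select ⟩
  sumSCT α (λ w → δ (comOf w) β) ∎
  where
  open ≡-Reasoning
  select : ∀ p → (if does (proj₁ p ≟c α) then 1 * δ (comOf (proj₂ p)) β else 0)
                 ≡ δ (proj₁ p) α * δ (comOf (proj₂ p)) β
  select p with proj₁ p ≟c α
  ... | yes _ = refl
  ... | no _ = refl

coeff-rhs : ∀ {m} (f : Vec ℕ (suc m)) (e : Vec ℕ m) β →
  coeff (rhs f e) β ≡ ∑[ γs ∈ tuples e ] prodD e γs * δ (assemble f γs) β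
coeff-rhs f e = coeff-map (prodD e) (assemble f) (tuples e)

∑-chains-suc : ∀ m (F : Comp × List ℕ → ℕ) →
  ∑ (chains (suc m)) F ≡ ∑[ p ∈ chains m ] ∑[ c ∈ covers (proj₁ p) ] F (proj₁ c , proj₂ p ∷ʳ proj₂ c)
∑-chains-suc m F =
  trans (∑-concatMap _ (chains m) F) (∑-cong (chains m) (λ p → ∑-map _ (covers (proj₁ p)) F))

sum≡0⇒[] : ∀ {σ} → All (1 ≤_) σ → sum σ ≡ 0 → σ ≡ []
sum≡0⇒[] [] _ = refl
sum≡0⇒[] (s≤s _ ∷ _) ()

-- Invariants of covers and chains

record Increment (σ : Comp) (c : Comp × ℕ) : Set where
  constructor mkIncrement
  field
    length-≡ : length (proj₁ c) ≡ length σ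
    sum-≡ : sum (proj₁ c) ≡ suc (sum σ)
    parts-pos : All (1 ≤_) (proj₁ c)
    col≥2 : 2 ≤ proj₂ c
    col≤2 : All (_≤ 2) (proj₁ c) → proj₂ c ≤ 2

incs-Increment : ∀ σ → All (1 ≤_) σ → All (Increment σ) (incs σ)
incs-Increment [] _ = []
incs-Increment (x ∷ xs) (px ∷ pxs) =
  mkIncrement refl refl (s≤s z≤n ∷ pxs) (s≤s px) All.head
  ∷ map⁺ (filter⁺ _ (All.map below (incs-Increment xs pxs)))
  where
  below : ∀ {c} → Increment xs c → Increment (x ∷ xs) (x ∷ proj₁ c , proj₂ c)
  below (mkIncrement l s p col≥ col≤) =
    mkIncrement (cong suc l) (trans (cong (x +_) s) (+-suc x _)) (px ∷ p) col≥ (col≤ ∘ All.tail)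

Increment⇒sum≥1 : ∀ {σ c} → All (1 ≤_) σ → Increment σ c → 1 ≤ sum σ
Increment⇒sum≥1 {[]} {[] , _} _ (mkIncrement _ () _ _ _)
Increment⇒sum≥1 {x ∷ σ} (px ∷ _) _ = ≤-trans px (m≤m+n x (sum σ))

Head≡1 : List ℕ → Set
Head≡1 [] = ⊤
Head≡1 (x ∷ _) = x ≡ 1

record ChainInv (m : ℕ) (p : Comp × List ℕ) : Set where
  constructor mkChainInv
  field
    shape-sum : sum (proj₁ p) ≡ m
    shape-pos : All (1 ≤_) (proj₁ p)
    cols-pos : All (1 ≤_) (proj₂ p)
    cols-length : length (proj₂ p) ≡ m
    cols-head : Head≡1 (proj₂ p)

chains-ChainInv : ∀ m → All (ChainInv m) (chains m)
chains-ChainInv zero = mkChainInv refl [] [] refl tt ∷ []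
chains-ChainInv (suc m) = concat⁺ (map⁺ (All.map (map⁺ ∘ step) (chains-ChainInv m)))
  where
  length-∷ʳ : ∀ (w : List ℕ) c → length w ≡ m → length (w ∷ʳ c) ≡ suc m
  length-∷ʳ w c l = trans (length-++ w) (trans (+-comm (length w) 1) (cong suc l))
  head-∷ʳ : ∀ w c → Head≡1 w → (w ≡ [] → c ≡ 1) → Head≡1 (w ∷ʳ c)
  head-∷ʳ [] c _ c≡1 = c≡1 refl
  head-∷ʳ (x ∷ w) c h _ = h
  step : ∀ {p} → ChainInv m p →
    All (λ c → ChainInv (suc m) (proj₁ c , proj₂ p ∷ʳ proj₂ c)) (covers (proj₁ p))
  step {σ , w} (mkChainInv s ps cs l h) =
    mkChainInv (cong suc s) (s≤s z≤n ∷ ps) (∷ʳ⁺ cs (s≤s z≤n)) (length-∷ʳ w 1 l)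
      (head-∷ʳ w 1 h λ _ → refl)
    ∷ All.map
        (λ {c} inc → mkChainInv (trans (Increment.sum-≡ inc) (cong suc s)) (Increment.parts-pos inc)
          (∷ʳ⁺ cs (≤-trans (s≤s z≤n) (Increment.col≥2 inc))) (length-∷ʳ w (proj₂ c) l)
          (head-∷ʳ w (proj₂ c) h λ { refl →
             contradiction (subst (1 ≤_) (trans s (sym l)) (Increment⇒sum≥1 ps inc)) λ () }))
        (incs-Increment σ ps)

sumSCT-cong-pos : ∀ α {h₁ h₂ : List ℕ → ℕ} →
  (∀ w → All (1 ≤_) w → h₁ w ≡ h₂ w) → sumSCT α h₁ ≡ sumSCT α h₂
sumSCT-cong-pos α eq =
  ∑-congᴬ (chains-ChainInv (sum α)) λ p inv → cong (δ (proj₁ p) α *_) (eq (proj₂ p) (ChainInv.cols-pos inv))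

sumSCT-cong-1∷ : ∀ α → 1 ≤ sum α → {h₁ h₂ : List ℕ → ℕ} →
  (∀ v → All (1 ≤_) v → h₁ (1 ∷ v) ≡ h₂ (1 ∷ v)) → sumSCT α h₁ ≡ sumSCT α h₂
sumSCT-cong-1∷ α α≥1 {h₁} {h₂} eq = ∑-congᴬ (chains-ChainInv (sum α)) first-cell
  where
  first-cell : ∀ p → ChainInv (sum α) p → δ (proj₁ p) α * h₁ (proj₂ p) ≡ δ (proj₁ p) α * h₂ (proj₂ p)
  first-cell (σ , []) inv = contradiction (≤-trans α≥1 (≤-reflexive (sym (ChainInv.cols-length inv)))) λ ()
  first-cell (σ , .1 ∷ v) (mkChainInv _ _ (_ ∷ v-pos) _ refl) = cong (δ σ α *_) (eq v v-pos)

-- Chains through a bottom block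

_EndsWith_ : Comp → Comp → Set
σ EndsWith ρ = ∃[ τ ] σ ≡ τ ++ ρ

increment-not-below : ∀ {σ c τ} → Increment σ c → σ ≢ τ ++ proj₁ c
increment-not-below {σ} {c} {τ} inc eq = m≢1+n+m (sum σ) (begin
  sum σ                          ≡⟨ cong sum eq ⟩
  sum (τ ++ proj₁ c)             ≡⟨ sum-++ τ (proj₁ c) ⟩
  sum τ + sum (proj₁ c)          ≡⟨ cong (sum τ +_) (Increment.sum-≡ inc) ⟩
  sum τ + suc (sum σ)            ≡⟨ +-suc (sum τ) (sum σ) ⟩
  suc (sum τ + sum σ)            ∎)
  where open ≡-Reasoning

increment-not-above : ∀ {ρ c} → Increment ρ c → ¬ (proj₁ c EndsWith ρ)
increment-not-above {ρ} inc ([] , eq) = m≢1+n+m (sum ρ) {0} (trans (cong sum (sym eq)) (Increment.sum-≡ inc))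
increment-not-above {ρ} inc (t ∷ ts , eq) = m≢1+n+m (length ρ)
  (trans (sym (Increment.length-≡ inc)) (trans (cong length eq) (cong suc (length-++ ts))))

-- Inside ρ only a row of length 1 below its top row could grow, but the top row 1 takes precedence.
incs-reflect-EndsWith : ∀ ρ σ → Head≡1 ρ → All (_≤ 2) ρ → All (1 ≤_) σ →
  All (λ c → proj₁ c EndsWith ρ → σ EndsWith ρ) (incs σ)
incs-reflect-EndsWith ρ [] _ _ _ = []
incs-reflect-EndsWith ρ (x ∷ xs) ρ₁≡1 ρ≤2 (px ∷ pxs) =
  top ∷ map⁺ (filter⁺-guarded _
    (All.zipWith below (incs-Increment xs pxs , incs-reflect-EndsWith ρ xs ρ₁≡1 ρ≤2 pxs)))
  where
  top : (suc x ∷ xs) EndsWith ρ → (x ∷ xs) EndsWith ρ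
  top ([] , eq) = contradiction (suc-injective (subst Head≡1 (sym eq) ρ₁≡1)) (m<n⇒n≢0 px)
  top (_ ∷ τ , eq) = x ∷ τ , cong (x ∷_) (∷-injectiveʳ eq)
  below : ∀ {c} → Increment xs c × (proj₁ c EndsWith ρ → xs EndsWith ρ) →
    proj₂ c ≢ suc x → (x ∷ proj₁ c) EndsWith ρ → (x ∷ xs) EndsWith ρ
  below {c} (inc , _) col≢ ([] , eq) = ⊥-elim (col≢ (≤-antisym
    (subst (λ y → proj₂ c ≤ suc y) (sym x≡1)
      (Increment.col≤2 inc (All.tail (subst (All (_≤ 2)) (sym eq) ρ≤2))))
    (subst (λ y → suc y ≤ proj₂ c) (sym x≡1) (Increment.col≥2 inc))))
    where
    x≡1 : x ≡ 1
    x≡1 = subst Head≡1 (sym eq) ρ₁≡1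
  below (_ , ih) _ (_ ∷ τ , eq) with ih (τ , ∷-injectiveʳ eq)
  ... | τ′ , eq′ = x ∷ τ′ , cong (x ∷_) eq′

sumSCT-1∷ : ∀ α → All (_≤ 2) α → (h : List ℕ → ℕ) →
  sumSCT (1 ∷ α) h ≡ sumSCT α (λ w → h (w ∷ʳ 1))
sumSCT-1∷ α α≤2 h = trans (∑-chains-suc (sum α) _) (∑-congᴬ (chains-ChainInv (sum α)) last-cell)
  where
  last-cell : ∀ p → ChainInv (sum α) p →
    ∑[ c ∈ covers (proj₁ p) ] δ (proj₁ c) (1 ∷ α) * h (proj₂ p ∷ʳ proj₂ c)
    ≡ δ (proj₁ p) α * h (proj₂ p ∷ʳ 1)
  last-cell (σ , w) inv = trans (cong₂ _+_ (cong (_* h (w ∷ʳ 1)) (δ-∷ 1 σ α)) no-increment) (+-identityʳ _)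
    where
    σ-pos = ChainInv.shape-pos inv
    no-increment : ∑[ c ∈ incs σ ] δ (proj₁ c) (1 ∷ α) * h (w ∷ʳ proj₂ c) ≡ 0
    no-increment = ∑-≡0
      (All.zip (incs-Increment σ σ-pos , incs-reflect-EndsWith (1 ∷ α) σ refl (s≤s z≤n ∷ α≤2) σ-pos))
      λ { c (inc , reflect) → cong (_* h (w ∷ʳ proj₂ c)) (δ-≢ λ eq →
          let τ , σ≡ = reflect ([] , eq) in increment-not-below inc (trans σ≡ (cong (τ ++_) (sym eq)))) }

sumSCT-ones++ : ∀ f α → All (_≤ 2) α → (h : List ℕ → ℕ) →
  sumSCT (replicate f 1 ++ α) h ≡ sumSCT α (λ w → h (w ++ replicate f 1))
sumSCT-ones++ zero α α≤2 h = sumSCT-cong α (λ w → cong h (sym (++-identityʳ w)))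
sumSCT-ones++ (suc f) α α≤2 h = begin
  sumSCT (1 ∷ replicate f 1 ++ α) h
    ≡⟨ sumSCT-1∷ (replicate f 1 ++ α) (++⁺ (replicate⁺ f (s≤s z≤n)) α≤2) h ⟩
  sumSCT (replicate f 1 ++ α) (λ w → h (w ∷ʳ 1))
    ≡⟨ sumSCT-ones++ f α α≤2 _ ⟩
  sumSCT α (λ w → h ((w ++ replicate f 1) ∷ʳ 1))
    ≡⟨ sumSCT-cong α (λ w → cong h
         (trans (++-assoc w (replicate f 1) (1 ∷ [])) (cong (w ++_) (replicate-∷ʳ f 1)))) ⟩
  sumSCT α (λ w → h (w ++ replicate (suc f) 1)) ∎
  where open ≡-Reasoning

stripSuffix : Comp → Comp → Maybe Comp
stripSuffix ρ σ with σ ≟c ρ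
... | yes _ = just []
stripSuffix ρ [] | no _ = nothing
stripSuffix ρ (x ∷ σ) | no _ = Data.Maybe.map (x ∷_) (stripSuffix ρ σ)

stripSuffix-sound : ∀ ρ σ {τ} → stripSuffix ρ σ ≡ just τ → σ ≡ τ ++ ρ
stripSuffix-sound ρ σ eq with σ ≟c ρ
stripSuffix-sound ρ σ refl | yes σ≡ρ = σ≡ρ
stripSuffix-sound ρ [] () | no _
stripSuffix-sound ρ (x ∷ σ) eq | no _ with stripSuffix ρ σ in eq′
stripSuffix-sound ρ (x ∷ σ) refl | no _ | just τ = cong (x ∷_) (stripSuffix-sound ρ σ eq′)

stripSuffix-∷ : ∀ ρ x σ → length ρ ≤ length σ →
  stripSuffix ρ (x ∷ σ) ≡ Data.Maybe.map (x ∷_) (stripSuffix ρ σ)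
stripSuffix-∷ ρ x σ ρ≤σ with (x ∷ σ) ≟c ρ
... | yes eq = contradiction (≤-trans (s≤s ρ≤σ) (≤-reflexive (cong length eq))) 1+n≰n
... | no _ = refl

stripSuffix-++ : ∀ ρ τ → stripSuffix ρ (τ ++ ρ) ≡ just τ
stripSuffix-++ ρ [] with ρ ≟c ρ
... | yes _ = refl
... | no ρ≢ρ = contradiction refl ρ≢ρ
stripSuffix-++ ρ (x ∷ τ) = begin
  stripSuffix ρ (x ∷ τ ++ ρ)                   ≡⟨ stripSuffix-∷ ρ x (τ ++ ρ) ρ≤τ++ρ ⟩
  Data.Maybe.map (x ∷_) (stripSuffix ρ (τ ++ ρ)) ≡⟨ cong (Data.Maybe.map (x ∷_)) (stripSuffix-++ ρ τ) ⟩
  just (x ∷ τ)                                 ∎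
  where
  open ≡-Reasoning
  ρ≤τ++ρ = ≤-trans (m≤n+m (length ρ) (length τ)) (≤-reflexive (sym (length-++ τ)))

_endsWith?_ : ∀ σ ρ → Dec (σ EndsWith ρ)
σ endsWith? ρ with stripSuffix ρ σ in eq
... | just τ = yes (τ , stripSuffix-sound ρ σ eq)
... | nothing = no λ { (τ , refl) → contradiction (trans (sym (stripSuffix-++ ρ τ)) eq) λ () }

above : Comp → (Comp → A → ℕ) → Comp → A → ℕ
above ρ G σ a = maybe′ (λ τ → G τ a) 0 (stripSuffix ρ σ)

above-++ : ∀ ρ τ (G : Comp → A → ℕ) a → above ρ G (τ ++ ρ) a ≡ G τ a
above-++ ρ τ G a = cong (maybe′ (λ τ → G τ a) 0) (stripSuffix-++ ρ τ)

above-¬EndsWith : ∀ {ρ σ} (G : Comp → A → ℕ) a → ¬ (σ EndsWith ρ) → above ρ G σ a ≡ 0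
above-¬EndsWith {ρ = ρ} {σ} G a ¬e with stripSuffix ρ σ in eq
... | just τ = contradiction (τ , stripSuffix-sound ρ σ eq) ¬e
... | nothing = refl

above-∷ : ∀ ρ x σ (G : Comp → A → ℕ) a → length ρ ≤ length σ →
  above ρ G (x ∷ σ) a ≡ above ρ (λ τ → G (x ∷ τ)) σ a
above-∷ ρ x σ G a ρ≤σ =
  trans (cong (maybe′ (λ τ → G τ a) 0) (stripSuffix-∷ ρ x σ ρ≤σ)) (maybe′-map _ 0 (x ∷_) (stripSuffix ρ σ))

above-if : ∀ ρ σ (G : Comp → A → ℕ) a b →
  (if b then above ρ G σ a else 0) ≡ above ρ (λ τ a → if b then G τ a else 0) σ a
above-if ρ σ G a true = refl
above-if ρ σ G a false with stripSuffix ρ σ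
... | just _ = refl
... | nothing = refl

∑-incs-above : ∀ ρ τ (K : Comp → ℕ → ℕ) → All (1 ≤_) (τ ++ ρ) →
  ∑[ c ∈ incs (τ ++ ρ) ] above ρ K (proj₁ c) (proj₂ c) ≡ ∑[ c ∈ incs τ ] K (proj₁ c) (proj₂ c)
∑-incs-above ρ [] K ρ-pos =
  ∑-≡0 (incs-Increment ρ ρ-pos) (λ c inc → above-¬EndsWith K (proj₂ c) (increment-not-above inc))
∑-incs-above ρ (x ∷ τ) K (_ ∷ τρ-pos) = cong₂ _+_ (above-++ ρ (suc x ∷ τ) K (suc x)) (begin
  ∑ (map lift (filter keep? (incs (τ ++ ρ)))) (λ c → above ρ K (proj₁ c) (proj₂ c))
    ≡⟨ ∑-map lift (filter keep? (incs (τ ++ ρ))) (λ c → above ρ K (proj₁ c) (proj₂ c)) ⟩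
  ∑[ c ∈ filter keep? (incs (τ ++ ρ)) ] above ρ K (x ∷ proj₁ c) (proj₂ c)
    ≡⟨ ∑-filter keep? (incs (τ ++ ρ)) _ ⟩
  ∑[ c ∈ incs (τ ++ ρ) ] (if does (keep? c) then above ρ K (x ∷ proj₁ c) (proj₂ c) else 0)
    ≡⟨ ∑-congᴬ (incs-Increment (τ ++ ρ) τρ-pos) kept ⟩
  ∑[ c ∈ incs (τ ++ ρ) ] above ρ K′ (proj₁ c) (proj₂ c)
    ≡⟨ ∑-incs-above ρ τ K′ τρ-pos ⟩
  ∑[ c ∈ incs τ ] K′ (proj₁ c) (proj₂ c)
    ≡⟨ ∑-filter keep? (incs τ) _ ⟨
  ∑[ c ∈ filter keep? (incs τ) ] K (x ∷ proj₁ c) (proj₂ c)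
    ≡⟨ ∑-map lift (filter keep? (incs τ)) (λ c → K (proj₁ c) (proj₂ c)) ⟨
  ∑ (map lift (filter keep? (incs τ))) (λ c → K (proj₁ c) (proj₂ c)) ∎)
  where
  open ≡-Reasoning
  lift : Comp × ℕ → Comp × ℕ
  lift (σ , col) = x ∷ σ , col
  keep? : (c : Comp × ℕ) → Dec (proj₂ c ≢ suc x)
  keep? c = ¬? (proj₂ c ≟ suc x)
  K′ : Comp → ℕ → ℕ
  K′ σ col = if does (keep? (σ , col)) then K (x ∷ σ) col else 0
  kept : ∀ c → Increment (τ ++ ρ) c →
    (if does (keep? c) then above ρ K (x ∷ proj₁ c) (proj₂ c) else 0) ≡ above ρ K′ (proj₁ c) (proj₂ c)
  kept c inc = trans (cong (λ n → if does (keep? c) then n else 0) (above-∷ ρ x (proj₁ c) K (proj₂ c) ρ≤c))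
                     (above-if ρ (proj₁ c) (λ σ → K (x ∷ σ)) (proj₂ c) (does (keep? c)))
    where
    ρ≤c = ≤-trans (m≤n+m (length ρ) (length τ))
                  (≤-reflexive (sym (trans (Increment.length-≡ inc) (length-++ τ))))

extend : (Comp → List ℕ → ℕ) → Comp → List ℕ → ℕ
extend G τ w = ∑[ c ∈ covers τ ] G (proj₁ c) (w ∷ʳ proj₂ c)

∑-covers-above : ∀ ρ σ → Head≡1 ρ → All (_≤ 2) ρ → All (1 ≤_) σ → sum ρ ≤ sum σ →
  ∀ G w → ∑[ c ∈ covers σ ] above ρ G (proj₁ c) (w ∷ʳ proj₂ c) ≡ above ρ (extend G) σ w
∑-covers-above ρ σ ρ₁≡1 ρ≤2 σ-pos ρ≤σ G w with σ endsWith? ρ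
... | yes (τ , refl) = trans
  (cong₂ _+_ (above-++ ρ (1 ∷ τ) G (w ∷ʳ 1)) (∑-incs-above ρ τ (λ τ′ col → G τ′ (w ∷ʳ col)) σ-pos))
  (sym (above-++ ρ τ (extend G) w))
... | no ¬e = trans (cong₂ _+_ (above-¬EndsWith G (w ∷ʳ 1) new-row) no-increment)
                   (sym (above-¬EndsWith (extend G) w ¬e))
  where
  new-row : ¬ ((1 ∷ σ) EndsWith ρ)
  new-row ([] , eq) = 1+n≰n (≤-trans (≤-reflexive (cong sum eq)) ρ≤σ)
  new-row (_ ∷ τ , eq) = ¬e (τ , ∷-injectiveʳ eq)
  no-increment : ∑[ c ∈ incs σ ] above ρ G (proj₁ c) (w ∷ʳ proj₂ c) ≡ 0
  no-increment = ∑-≡0 (incs-reflect-EndsWith ρ σ ρ₁≡1 ρ≤2 σ-pos)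
    (λ c reflect → above-¬EndsWith G (w ∷ʳ proj₂ c) (¬e ∘ reflect))

∑-chains-extend : ∀ m (G : Comp → List ℕ → ℕ) u →
  ∑[ q ∈ chains m ] extend G (proj₁ q) (u ++ proj₂ q) ≡ ∑[ q ∈ chains (suc m) ] G (proj₁ q) (u ++ proj₂ q)
∑-chains-extend m G u = sym (trans (∑-chains-suc m (λ q → G (proj₁ q) (u ++ proj₂ q)))
  (∑-cong (chains m) λ q → ∑-cong (covers (proj₁ q)) λ c →
    cong (G (proj₁ c)) (sym (++-assoc u (proj₂ q) (proj₂ c ∷ [])))))

∑-chains-above : ∀ ρ → Head≡1 ρ → All (_≤ 2) ρ → ∀ m (G : Comp → List ℕ → ℕ) →
  ∑[ p ∈ chains (sum ρ + m) ] above ρ G (proj₁ p) (proj₂ p)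
  ≡ ∑[ p ∈ chains (sum ρ) ] δ (proj₁ p) ρ * (∑[ q ∈ chains m ] G (proj₁ q) (proj₂ p ++ proj₂ q))
∑-chains-above ρ ρ₁≡1 ρ≤2 zero G =
  trans (cong (λ n → ∑[ p ∈ chains n ] above ρ G (proj₁ p) (proj₂ p)) (+-identityʳ (sum ρ)))
        (∑-congᴬ (chains-ChainInv (sum ρ)) only-ρ)
  where
  only-ρ : ∀ p → ChainInv (sum ρ) p →
    above ρ G (proj₁ p) (proj₂ p) ≡ δ (proj₁ p) ρ * (G [] (proj₂ p ++ []) + 0)
  only-ρ (σ , w) inv with σ endsWith? ρ
  ... | no ¬e =
    trans (above-¬EndsWith G w ¬e) (sym (cong (_* (G [] (w ++ []) + 0)) (δ-≢ λ eq → ¬e ([] , eq))))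
  ... | yes (τ , refl) with sum≡0⇒[] (++⁻ˡ τ (ChainInv.shape-pos inv))
                          (+-cancelʳ-≡ (sum ρ) (sum τ) 0 (trans (sym (sum-++ τ ρ)) (ChainInv.shape-sum inv)))
  ...   | refl = begin
    above ρ G ρ w                ≡⟨ above-++ ρ [] G w ⟩
    G [] w                       ≡⟨ cong (G []) (++-identityʳ w) ⟨
    G [] (w ++ [])               ≡⟨ +-identityʳ _ ⟨
    G [] (w ++ []) + 0           ≡⟨ *-identityˡ _ ⟨
    1 * (G [] (w ++ []) + 0)     ≡⟨ cong (_* (G [] (w ++ []) + 0)) (δ-refl ρ) ⟨
    δ ρ ρ * (G [] (w ++ []) + 0) ∎
    where open ≡-Reasoning
∑-chains-above ρ ρ₁≡1 ρ≤2 (suc m) G = begin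
  ∑[ p ∈ chains (sum ρ + suc m) ] above ρ G (proj₁ p) (proj₂ p)
    ≡⟨ cong (λ n → ∑[ p ∈ chains n ] above ρ G (proj₁ p) (proj₂ p)) (+-suc (sum ρ) m) ⟩
  ∑[ p ∈ chains (suc (sum ρ + m)) ] above ρ G (proj₁ p) (proj₂ p)
    ≡⟨ ∑-chains-suc (sum ρ + m) _ ⟩
  ∑[ p ∈ chains (sum ρ + m) ] ∑[ c ∈ covers (proj₁ p) ] above ρ G (proj₁ c) (proj₂ p ∷ʳ proj₂ c)
    ≡⟨ ∑-congᴬ (chains-ChainInv (sum ρ + m)) last-step ⟩
  ∑[ p ∈ chains (sum ρ + m) ] above ρ (extend G) (proj₁ p) (proj₂ p)
    ≡⟨ ∑-chains-above ρ ρ₁≡1 ρ≤2 m (extend G) ⟩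
  ∑[ p ∈ chains (sum ρ) ] δ (proj₁ p) ρ * (∑[ q ∈ chains m ] extend G (proj₁ q) (proj₂ p ++ proj₂ q))
    ≡⟨ ∑-cong (chains (sum ρ)) (λ p → cong (δ (proj₁ p) ρ *_) (∑-chains-extend m G (proj₂ p))) ⟩
  ∑[ p ∈ chains (sum ρ) ] δ (proj₁ p) ρ * (∑[ q ∈ chains (suc m) ] G (proj₁ q) (proj₂ p ++ proj₂ q)) ∎
  where
  open ≡-Reasoning
  last-step : ∀ p → ChainInv (sum ρ + m) p →
    ∑[ c ∈ covers (proj₁ p) ] above ρ G (proj₁ c) (proj₂ p ∷ʳ proj₂ c)
    ≡ above ρ (extend G) (proj₁ p) (proj₂ p)
  last-step (σ , w) (mkChainInv σ-sum σ-pos _ _ _) =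
    ∑-covers-above ρ σ ρ₁≡1 ρ≤2 σ-pos (≤-trans (m≤m+n (sum ρ) m) (≤-reflexive (sym σ-sum))) G w

sumSCT-++ : ∀ ρ τ → Head≡1 ρ → All (_≤ 2) ρ → (h : List ℕ → ℕ) →
  sumSCT (τ ++ ρ) h ≡ sumSCT ρ (λ w → sumSCT τ (λ v → h (w ++ v)))
sumSCT-++ ρ τ ρ₁≡1 ρ≤2 h = begin
  ∑[ p ∈ chains (sum (τ ++ ρ)) ] δ (proj₁ p) (τ ++ ρ) * h (proj₂ p)
    ≡⟨ cong (λ n → ∑[ p ∈ chains n ] δ (proj₁ p) (τ ++ ρ) * h (proj₂ p))
            (trans (sum-++ τ ρ) (+-comm (sum τ) (sum ρ))) ⟩
  ∑[ p ∈ chains (sum ρ + sum τ) ] δ (proj₁ p) (τ ++ ρ) * h (proj₂ p)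
    ≡⟨ ∑-cong (chains (sum ρ + sum τ)) split ⟩
  ∑[ p ∈ chains (sum ρ + sum τ) ] above ρ (λ σ w → δ σ τ * h w) (proj₁ p) (proj₂ p)
    ≡⟨ ∑-chains-above ρ ρ₁≡1 ρ≤2 (sum τ) _ ⟩
  sumSCT ρ (λ w → sumSCT τ (λ v → h (w ++ v))) ∎
  where
  open ≡-Reasoning
  split : ∀ p → δ (proj₁ p) (τ ++ ρ) * h (proj₂ p) ≡ above ρ (λ σ w → δ σ τ * h w) (proj₁ p) (proj₂ p)
  split (σ , w) with σ endsWith? ρ
  ... | yes (τ′ , refl) = trans (cong (_* h w) (δ-⇔ (++-cancelʳ ρ τ′ τ) (cong (_++ ρ))))
                                (sym (above-++ ρ τ′ (λ σ w → δ σ τ * h w) w))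
  ... | no ¬e = trans (cong (_* h w) (δ-≢ λ eq → ¬e (τ , eq)))
                      (sym (above-¬EndsWith (λ σ w → δ σ τ * h w) w ¬e))

-- Descent compositions

comFrom-ones++ : ∀ f R → All (1 ≤_) R → comFrom 1 (replicate f 1 ++ R) ≡ replicate f 1 ++ comFrom 1 R
comFrom-ones++ zero R _ = refl
comFrom-ones++ (suc zero) [] _ = refl
comFrom-ones++ (suc zero) (suc k ∷ R) _ = refl
comFrom-ones++ (suc zero) (zero ∷ R) (() ∷ _)
comFrom-ones++ (suc (suc f)) R R-pos = cong (1 ∷_) (comFrom-ones++ (suc f) R R-pos)

comFrom-++ : ∀ acc X {a b} Y → a ≤ b →
  comFrom acc (X ++ a ∷ b ∷ Y) ≡ comFrom acc (X ∷ʳ a) ++ comFrom 1 (b ∷ Y)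
comFrom-++ acc [] {a} {b} Y a≤b with a ≤ᵇ b | ≤⇒≤ᵇ a≤b
... | true | _ = refl
comFrom-++ acc (x ∷ []) {a} {b} Y a≤b = trans
  (cong₂ (if_then_else_ (x ≤ᵇ a))
    (cong (acc ∷_) (comFrom-++ 1 [] Y a≤b)) (comFrom-++ (suc acc) [] Y a≤b))
  (sym (if-float (_++ comFrom 1 (b ∷ Y)) (x ≤ᵇ a)))
comFrom-++ acc (x ∷ y ∷ X) {b = b} Y a≤b = trans
  (cong₂ (if_then_else_ (x ≤ᵇ y))
    (cong (acc ∷_) (comFrom-++ 1 (y ∷ X) Y a≤b)) (comFrom-++ (suc acc) (y ∷ X) Y a≤b))
  (sym (if-float (_++ comFrom 1 (b ∷ Y)) (x ≤ᵇ y)))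

comOf-stack : ∀ f v w → All (1 ≤_) v → All (1 ≤_) w →
  comOf ((w ++ 1 ∷ v) ++ replicate f 1) ≡ replicate f 1 ++ (comOf (1 ∷ v) ++ comOf w)
comOf-stack f v w v-pos w-pos = begin
  comFrom 1 (reverse ((w ++ 1 ∷ v) ++ replicate f 1))
    ≡⟨ cong (comFrom 1) reversed ⟩
  comFrom 1 (replicate f 1 ++ (reverse v ++ 1 ∷ reverse w))
    ≡⟨ comFrom-ones++ f _ (++⁺ (All-reverse⁺ v-pos) (s≤s z≤n ∷ All-reverse⁺ w-pos)) ⟩
  replicate f 1 ++ comFrom 1 (reverse v ++ 1 ∷ reverse w)
    ≡⟨ cong (replicate f 1 ++_) (junction (reverse w) (All-reverse⁺ w-pos)) ⟩
  replicate f 1 ++ (comFrom 1 (reverse v ∷ʳ 1) ++ comOf w)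
    ≡⟨ cong (λ u → replicate f 1 ++ (comFrom 1 u ++ comOf w)) (unfold-reverse 1 v) ⟨
  replicate f 1 ++ (comOf (1 ∷ v) ++ comOf w) ∎
  where
  open ≡-Reasoning
  junction : ∀ R → All (1 ≤_) R → comFrom 1 (reverse v ++ 1 ∷ R) ≡ comFrom 1 (reverse v ∷ʳ 1) ++ comFrom 1 R
  junction [] _ = sym (++-identityʳ _)
  junction (b ∷ R) (1≤b ∷ _) = comFrom-++ 1 (reverse v) R 1≤b
  reversed : reverse ((w ++ 1 ∷ v) ++ replicate f 1) ≡ replicate f 1 ++ (reverse v ++ 1 ∷ reverse w)
  reversed = begin
    reverse ((w ++ 1 ∷ v) ++ replicate f 1)
      ≡⟨ reverse-++ (w ++ 1 ∷ v) (replicate f 1) ⟩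
    reverse (replicate f 1) ++ reverse (w ++ 1 ∷ v)
      ≡⟨ cong₂ _++_ (reverse-replicate f 1) (reverse-++ w (1 ∷ v)) ⟩
    replicate f 1 ++ (reverse (1 ∷ v) ++ reverse w)
      ≡⟨ cong (λ u → replicate f 1 ++ (u ++ reverse w)) (unfold-reverse 1 v) ⟩
    replicate f 1 ++ ((reverse v ∷ʳ 1) ++ reverse w)
      ≡⟨ cong (replicate f 1 ++_) (++-assoc (reverse v) (1 ∷ []) (reverse w)) ⟩
    replicate f 1 ++ (reverse v ++ 1 ∷ reverse w) ∎

sum-comFrom : ∀ acc x L → sum (comFrom acc (x ∷ L)) ≡ acc + length L
sum-comFrom acc x [] = refl
sum-comFrom acc x (y ∷ L) with x ≤ᵇ y
... | true = cong (acc +_) (sum-comFrom 1 y L)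
... | false = trans (sum-comFrom (suc acc) y L) (sym (+-suc acc (length L)))

sum-comOf : ∀ w → sum (comOf w) ≡ length w
sum-comOf w = trans (sum-comFrom-1 (reverse w)) (length-reverse w)
  where
  sum-comFrom-1 : ∀ L → sum (comFrom 1 L) ≡ length L
  sum-comFrom-1 [] = refl
  sum-comFrom-1 (x ∷ L) = sum-comFrom 1 x L

comFrom-pos : ∀ acc x L → All (1 ≤_) (comFrom (suc acc) (x ∷ L))
comFrom-pos acc x [] = s≤s z≤n ∷ []
comFrom-pos acc x (y ∷ L) with x ≤ᵇ y
... | true = s≤s z≤n ∷ comFrom-pos 0 y L
... | false = comFrom-pos (suc acc) y L

comOf-pos : ∀ w → All (1 ≤_) (comOf w)
comOf-pos w with reverse w
... | [] = []
... | x ∷ L = comFrom-pos 0 x L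

compsSuc-pos : ∀ n → All (All (1 ≤_)) (compsSuc n)
compsSuc-pos zero = (s≤s z≤n ∷ []) ∷ []
compsSuc-pos (suc n) = concat⁺ (map⁺ (All.map
  (λ { {[]} _ → [] ; {x ∷ xs} (px ∷ pxs) → (s≤s z≤n ∷ px ∷ pxs) ∷ (s≤s z≤n ∷ pxs) ∷ [] })
  (compsSuc-pos n)))

-- Expansion in fundamental quasisymmetric functions

∑-δ-compsSuc : ∀ n c → All (1 ≤_) c → sum c ≡ suc n → ∑[ γ ∈ compsSuc n ] δ c γ ≡ 1
∑-δ-compsSuc zero (suc x ∷ c) (_ ∷ c-pos) eq
  with m+n≡0⇒m≡0 x (suc-injective eq) | sum≡0⇒[] c-pos (m+n≡0⇒n≡0 x (suc-injective eq))
... | refl | refl = refl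
∑-δ-compsSuc (suc n) (suc zero ∷ c) (_ ∷ c-pos) eq =
  trans (∑-concatMap _ (compsSuc n) (δ (1 ∷ c))) (trans
    (∑-congᴬ {g = δ c} (compsSuc-pos n) λ
      { [] _ → sym (δ-≢ {c} {[]} λ c≡[] → 0≢1+n (trans (sym (cong sum c≡[])) (suc-injective eq)))
      ; (x ∷ γ) (x≥1 ∷ _) → trans
          (cong₂ _+_ (δ-∷ 1 c (x ∷ γ))
                     (cong (_+ 0) (δ-≢ {1 ∷ c} {suc x ∷ γ} λ eq′ →
                       m<n⇒n≢0 x≥1 (sym (suc-injective (∷-injectiveˡ eq′))))))
          (+-identityʳ _) })
    (∑-δ-compsSuc n c c-pos (suc-injective eq)))
∑-δ-compsSuc (suc n) (suc (suc k) ∷ c) (_ ∷ c-pos) eq =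
  trans (∑-concatMap _ (compsSuc n) (δ (suc (suc k) ∷ c))) (trans
    (∑-congᴬ {g = δ (suc k ∷ c)} (compsSuc-pos n) λ
      { [] _ → sym (δ-≢ {suc k ∷ c} {[]} λ ())
      ; (x ∷ γ) _ → cong₂ _+_
          (δ-≢ {suc (suc k) ∷ c} {1 ∷ x ∷ γ} λ eq′ → 0≢1+n (suc-injective (sym (∷-injectiveˡ eq′))))
          (trans (+-identityʳ _) (δ-suc (suc k) x c γ)) })
    (∑-δ-compsSuc n (suc k ∷ c) (s≤s z≤n ∷ c-pos) (suc-injective eq)))

∑-δ-comps-* : ∀ c (K : Comp → ℕ) → All (1 ≤_) c → ∑[ γ ∈ comps (sum c) ] δ c γ * K γ ≡ K c
∑-δ-comps-* c K c-pos = begin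
  ∑[ γ ∈ comps (sum c) ] δ c γ * K γ   ≡⟨ ∑-cong (comps (sum c)) (λ γ → δ-*-cong c γ (cong K)) ⟨
  ∑[ γ ∈ comps (sum c) ] δ c γ * K c   ≡⟨ ∑-*ʳ (K c) (comps (sum c)) (δ c) ⟨
  ∑ (comps (sum c)) (δ c) * K c        ≡⟨ cong (_* K c) (∑-δ-comps (sum c) refl) ⟩
  1 * K c                              ≡⟨ *-identityˡ (K c) ⟩
  K c                                  ∎
  where
  open ≡-Reasoning
  ∑-δ-comps : ∀ n → sum c ≡ n → ∑ (comps n) (δ c) ≡ 1
  ∑-δ-comps zero eq rewrite sum≡0⇒[] c-pos eq = refl
  ∑-δ-comps (suc n) eq = ∑-δ-compsSuc n c c-pos eq

∑-d-comps : ∀ α (K : Comp → ℕ) → ∑[ γ ∈ comps (sum α) ] d α γ * K γ ≡ sumSCT α (λ w → K (comOf w))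
∑-d-comps α K = begin
  ∑[ γ ∈ comps (sum α) ] d α γ * K γ
    ≡⟨ ∑-cong (comps (sum α)) (λ γ → trans (cong (_* K γ) (coeff-S α γ)) (∑-*ʳ (K γ) (chains (sum α)) _)) ⟩
  ∑[ γ ∈ comps (sum α) ] ∑[ p ∈ chains (sum α) ] δ (proj₁ p) α * δ (comOf (proj₂ p)) γ * K γ
    ≡⟨ ∑-swap (comps (sum α)) (chains (sum α)) _ ⟩
  ∑[ p ∈ chains (sum α) ] ∑[ γ ∈ comps (sum α) ] δ (proj₁ p) α * δ (comOf (proj₂ p)) γ * K γ
    ≡⟨ ∑-congᴬ (chains-ChainInv (sum α)) select ⟩
  sumSCT α (λ w → K (comOf w)) ∎
  where
  open ≡-Reasoning
  select : ∀ p → ChainInv (sum α) p →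
    ∑[ γ ∈ comps (sum α) ] δ (proj₁ p) α * δ (comOf (proj₂ p)) γ * K γ
    ≡ δ (proj₁ p) α * K (comOf (proj₂ p))
  select (σ , w) inv = begin
    ∑[ γ ∈ comps (sum α) ] δ σ α * δ (comOf w) γ * K γ
      ≡⟨ ∑-cong (comps (sum α)) (λ γ → *-assoc (δ σ α) _ (K γ)) ⟩
    ∑[ γ ∈ comps (sum α) ] δ σ α * (δ (comOf w) γ * K γ)
      ≡⟨ ∑-*ˡ (δ σ α) (comps (sum α)) _ ⟨
    δ σ α * (∑[ γ ∈ comps (sum α) ] δ (comOf w) γ * K γ)
      ≡⟨ cong (λ n → δ σ α * (∑[ γ ∈ comps n ] δ (comOf w) γ * K γ)) |comOf-w|≡|α| ⟨
    δ σ α * (∑[ γ ∈ comps (sum (comOf w)) ] δ (comOf w) γ * K γ)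
      ≡⟨ cong (δ σ α *_) (∑-δ-comps-* (comOf w) K (comOf-pos w)) ⟩
    δ σ α * K (comOf w) ∎
    where
    |comOf-w|≡|α| = trans (sum-comOf w) (ChainInv.cols-length inv)

-- The shape (1^{f₁}, 2^{e₁}, …, 2^{e_{k−1}}, 1^{f_k})

comOf-ones : ∀ f → comOf (replicate f 1) ≡ replicate f 1
comOf-ones f = begin
  comFrom 1 (reverse (replicate f 1))
    ≡⟨ cong (comFrom 1) (trans (reverse-replicate f 1) (sym (++-identityʳ _))) ⟩
  comFrom 1 (replicate f 1 ++ [])
    ≡⟨ comFrom-ones++ f [] [] ⟩
  replicate f 1 ++ []
    ≡⟨ ++-identityʳ _ ⟩
  replicate f 1 ∎
  where open ≡-Reasoning

sum-replicate-2 : ∀ e → sum (replicate e 2) ≡ 2 * e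
sum-replicate-2 zero = refl
sum-replicate-2 (suc e) = trans (cong (2 +_) (sum-replicate-2 e)) (sym (*-suc 2 e))

sumSCT-block : ∀ f e ρ → 1 ≤ e → Head≡1 ρ → All (_≤ 2) ρ → (g : Comp → ℕ) →
  sumSCT (replicate f 1 ++ replicate e 2 ++ ρ) (λ w → g (comOf w))
  ≡ ∑[ γ ∈ comps (2 * e) ] d (replicate e 2) γ * sumSCT ρ (λ w → g (replicate f 1 ++ γ ++ comOf w))
sumSCT-block f e ρ e≥1 ρ₁≡1 ρ≤2 g = begin
  sumSCT (replicate f 1 ++ β ++ ρ) (λ w → g (comOf w))
    ≡⟨ sumSCT-ones++ f (β ++ ρ) (++⁺ (replicate⁺ e ≤-refl) ρ≤2) _ ⟩
  sumSCT (β ++ ρ) (λ w → g (comOf (w ++ replicate f 1)))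
    ≡⟨ sumSCT-++ ρ β ρ₁≡1 ρ≤2 _ ⟩
  sumSCT ρ (λ w → sumSCT β (λ v → g (comOf ((w ++ v) ++ replicate f 1))))
    ≡⟨ sumSCT-cong-pos ρ (λ w w-pos → sumSCT-cong-1∷ β |β|≥1 λ v v-pos →
         cong g (comOf-stack f v w v-pos w-pos)) ⟩
  sumSCT ρ (λ w → sumSCT β (λ v → g (replicate f 1 ++ comOf v ++ comOf w)))
    ≡⟨ sumSCT-swap ρ β (λ w v → g (replicate f 1 ++ comOf v ++ comOf w)) ⟩
  sumSCT β (λ v → sumSCT ρ (λ w → g (replicate f 1 ++ comOf v ++ comOf w)))
    ≡⟨ ∑-d-comps β (λ γ → sumSCT ρ (λ w → g (replicate f 1 ++ γ ++ comOf w))) ⟨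
  ∑[ γ ∈ comps (sum β) ] d β γ * sumSCT ρ (λ w → g (replicate f 1 ++ γ ++ comOf w))
    ≡⟨ cong (λ n → ∑[ γ ∈ comps n ] d β γ * sumSCT ρ (λ w → g (replicate f 1 ++ γ ++ comOf w)))
            (sum-replicate-2 e) ⟩
  ∑[ γ ∈ comps (2 * e) ] d β γ * sumSCT ρ (λ w → g (replicate f 1 ++ γ ++ comOf w)) ∎
  where
  open ≡-Reasoning
  β = replicate e 2
  |β|≥1 = ≤-trans (≤-trans e≥1 (m≤n*m e 2)) (≤-reflexive (sym (sum-replicate-2 e)))

alphaShape-≤2 : ∀ {m} (f : Vec ℕ (suc m)) (e : Vec ℕ m) → All (_≤ 2) (alphaShape f e)
alphaShape-≤2 (f ∷ []) [] = replicate⁺ f (s≤s z≤n)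
alphaShape-≤2 (f ∷ fs@(_ ∷ _)) (e ∷ es) =
  ++⁺ (replicate⁺ f (s≤s z≤n)) (++⁺ (replicate⁺ e ≤-refl) (alphaShape-≤2 fs es))

alphaShape-head : ∀ {m} f₀ (fs : Vec ℕ m) (es : Vec ℕ m) →
  (0 < m → 1 ≤ f₀) → Head≡1 (alphaShape (f₀ ∷ fs) es)
alphaShape-head zero [] [] _ = tt
alphaShape-head (suc f₀) [] [] _ = refl
alphaShape-head zero (_ ∷ _) (_ ∷ _) f₀≥1 = contradiction (f₀≥1 (s≤s z≤n)) λ ()
alphaShape-head (suc f₀) (_ ∷ _) (_ ∷ _) _ = refl

∑-tuples-∷ : ∀ {m} e (es : Vec ℕ m) (F : Vec Comp (suc m) → ℕ) →
  ∑ (tuples (e ∷ es)) F ≡ ∑[ γ ∈ comps (2 * e) ] ∑[ γs ∈ tuples es ] F (γ ∷ γs)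
∑-tuples-∷ e es F =
  trans (∑-concatMap _ (comps (2 * e)) F) (∑-cong (comps (2 * e)) λ γ → ∑-map (γ ∷_) (tuples es) F)

sumSCT-alphaShape : ∀ m (f : Vec ℕ (suc m)) (e : Vec ℕ m) →
  (∀ (i : Fin m) → 1 ≤ lookup e i) →
  (∀ (i : Fin (suc m)) → 0 < toℕ i → toℕ i < m → 1 ≤ lookup f i) →
  (g : Comp → ℕ) →
  sumSCT (alphaShape f e) (λ w → g (comOf w)) ≡ ∑[ γs ∈ tuples e ] prodD e γs * g (assemble f γs)
sumSCT-alphaShape zero (f ∷ []) [] _ _ g = begin
  sumSCT (replicate f 1) (λ w → g (comOf w))
    ≡⟨ cong (λ α → sumSCT α (λ w → g (comOf w))) (++-identityʳ (replicate f 1)) ⟨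
  sumSCT (replicate f 1 ++ []) (λ w → g (comOf w))
    ≡⟨ sumSCT-ones++ f [] [] _ ⟩
  1 * g (comOf (replicate f 1)) + 0
    ≡⟨ cong (λ γ → 1 * g γ + 0) (comOf-ones f) ⟩
  1 * g (replicate f 1) + 0 ∎
  where open ≡-Reasoning
sumSCT-alphaShape (suc m) (f ∷ f′ ∷ fs) (e ∷ es) e≥1 f≥1 g = begin
  sumSCT (replicate f 1 ++ β ++ ρ) (λ w → g (comOf w))
    ≡⟨ sumSCT-block f e ρ (e≥1 fzero) ρ₁≡1 (alphaShape-≤2 (f′ ∷ fs) es) g ⟩
  ∑[ γ ∈ comps (2 * e) ] d β γ * sumSCT ρ (λ w → g (replicate f 1 ++ γ ++ comOf w))
    ≡⟨ ∑-cong (comps (2 * e)) (λ γ → cong (d β γ *_) (sumSCT-alphaShape m (f′ ∷ fs) es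
         (e≥1 ∘ fsuc) (λ i _ i<m → f≥1 (fsuc i) (s≤s z≤n) (s≤s i<m))
         (λ γ′ → g (replicate f 1 ++ γ ++ γ′)))) ⟩
  ∑[ γ ∈ comps (2 * e) ] d β γ *
    (∑[ γs ∈ tuples es ] prodD es γs * g (replicate f 1 ++ γ ++ assemble (f′ ∷ fs) γs))
    ≡⟨ ∑-cong (comps (2 * e)) (λ γ → trans (∑-*ˡ (d β γ) (tuples es) _)
         (∑-cong (tuples es) λ γs → sym (*-assoc (d β γ) (prodD es γs) _))) ⟩
  ∑[ γ ∈ comps (2 * e) ] ∑[ γs ∈ tuples es ]
    prodD (e ∷ es) (γ ∷ γs) * g (assemble (f ∷ f′ ∷ fs) (γ ∷ γs))
    ≡⟨ ∑-tuples-∷ e es _ ⟨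
  ∑[ γs ∈ tuples (e ∷ es) ] prodD (e ∷ es) γs * g (assemble (f ∷ f′ ∷ fs) γs) ∎
  where
  open ≡-Reasoning
  β = replicate e 2
  ρ = alphaShape (f′ ∷ fs) es
  ρ₁≡1 = alphaShape-head f′ fs es λ 0<m → f≥1 (fsuc fzero) (s≤s z≤n) (s≤s 0<m)

lemma6p2 : (m : ℕ) (f : Vec ℕ (suc m)) (e : Vec ℕ m)
    → (∀ (i : Fin m) → 1 ≤ lookup e i)
    → (∀ (i : Fin (suc m)) → 0 < toℕ i → toℕ i < m → 1 ≤ lookup f i)
    → ∀ (β : Comp) → coeff (S (alphaShape f e)) β ≡ coeff (rhs f e) β
lemma6p2 m f e e≥1 f≥1 β = begin
  coeff (S (alphaShape f e)) β                          ≡⟨ coeff-S (alphaShape f e) β ⟩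
  sumSCT (alphaShape f e) (λ w → δ (comOf w) β)         ≡⟨ sumSCT-alphaShape m f e e≥1 f≥1 (λ γ → δ γ β) ⟩
  ∑[ γs ∈ tuples e ] prodD e γs * δ (assemble f γs) β   ≡⟨ coeff-rhs f e β ⟨
  coeff (rhs f e) β                                     ∎
  where open ≡-Reasoning
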